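{- Let $\mathcal{N}$ be a normalized family. Then $\mathcal{N}$ is isomorphic to $J(\mathcal{N})^{**}=(J(\mathcal{N})^*)^*$.
   Context: Families are finite sets of finite sets; $U(\mathcal{L})$ is the union of the members of $\mathcal{L}$. $\mathcal{N}$ is normalized if it is union-closed, separating (for distinct $a,b\in U(\mathcal{N})$ some $O\in\mathcal{N}$ has $|O\cap\{a,b\}|=1$), $\emptyset\in\mathcal{N}$ and $|\mathcal{N}|=|U(\mathcal{N})|+1$. A member $F$ is irreducible if $F=G\cup H$ with $G,H$ members implies $G=F$ or $H=F$; $J(\mathcal{F})$ is the set of non-empty irreducible members of $\mathcal{F}$. Dual: for a finite family $\mathcal{L}$, enumerate its distinct non-empty members as $H_1,\dots,H_s$; for $j\in U(\mathcal{L})$ set $\mathcal{H}^{\iota_j}=\{i\in[s]:j\in H_i\}$; then $\mathcal{L}^*=\{\bigcup_{j\in A}\mathcal{H}^{\iota_j}:A\subseteq U(\mathcal{L})\}$. This is well defined up to isomorphism (families are isomorphic if a bijection between universes carries one onto the other). -}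

module Defs where

open import Data.Nat using (ℕ; zero; suc; _+_)
open import Data.Bool using (Bool; true; false; _∧_; _∨_; not)
import Data.Bool as Bool
open import Data.Fin using (Fin)
open import Data.List using (List; []; _∷_; _++_; map; filterᵇ; length; lookup)
open import Data.Bool.ListAction using (all; any)
open import Data.Vec using (Vec; tabulate; allFin; toList)
import Data.Vec as Vec
open import Data.Vec.Properties using (≡-dec)
open import Data.Fin.Subset using (Subset; _∈_; _∉_; _⊆_; _∪_; ⋃; ∣_∣; outside; inside)
  renaming (⊥ to ∅)
open import Data.Fin.Subset.Properties using (nonempty?; _⊆?_)
open import Data.Product using (Σ; _×_)
open import Data.Sum using (_⊎_)
open import Relation.Nullary using (does; ¬_)
open import Relation.Binary.PropositionalEquality using (_≡_)
open import Function.Bundles using (_⇔_)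

-- Finite sets are subsets of a ground set Fin n (bit vectors);
-- a family over Fin n is a finite set of such subsets, i.e. a
-- Boolean predicate on Subset n (X is a member iff F X ≡ true).
-- The union U(F) of the members is a subset of Fin n, possibly proper.

Family : ℕ → Set
Family n = Subset n → Bool

_≟ˢ_ : ∀ {n} → Subset n → Subset n → Bool
X ≟ˢ Y = does (≡-dec Bool._≟_ X Y)

allSubsets : ∀ n → List (Subset n)
allSubsets zero = Vec.[] ∷ []
allSubsets (suc n) = map (outside Vec.∷_) (allSubsets n) ++ map (inside Vec.∷_) (allSubsets n)

members : ∀ {n} → Family n → List (Subset n)
members {n} F = filterᵇ F (allSubsets n)

card : ∀ {n} → Family n → ℕ
card F = length (members F)

U : ∀ {n} → Family n → Subset n
U F = ⋃ (members F)

UnionClosed : ∀ {n} → Family n → Set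
UnionClosed F = ∀ X Y → F X ≡ true → F Y ≡ true → F (X ∪ Y) ≡ true

Separating : ∀ {n} → Family n → Set
Separating {n} F = ∀ (a b : Fin n) → a ∈ U F → b ∈ U F → ¬ (a ≡ b) →
  Σ (Subset n) λ O → F O ≡ true × ((a ∈ O × b ∉ O) ⊎ (a ∉ O × b ∈ O))

record Normalized {n} (F : Family n) : Set where
  field
    unionClosed : UnionClosed F
    separating  : Separating F
    hasEmpty    : F ∅ ≡ true
    cardinality : card F ≡ ∣ U F ∣ + 1

irreducible : ∀ {n} → Family n → Subset n → Bool
irreducible {n} F X =
  all (λ G → all (λ H →
        not (F G ∧ F H ∧ ((G ∪ H) ≟ˢ X)) ∨ (G ≟ˢ X) ∨ (H ≟ˢ X))
      (allSubsets n)) (allSubsets n)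

J : ∀ {n} → Family n → Family n
J F X = F X ∧ does (nonempty? X) ∧ irreducible F X

nonemptyMembers : ∀ {n} → Family n → List (Subset n)
nonemptyMembers {n} L = filterᵇ (λ X → L X ∧ does (nonempty? X)) (allSubsets n)

dsize : ∀ {n} → Family n → ℕ
dsize L = length (nonemptyMembers L)

Hᵢ : ∀ {n} (L : Family n) → Fin (dsize L) → Subset n
Hᵢ L i = lookup (nonemptyMembers L) i

ι : ∀ {n} (L : Family n) → Fin n → Subset (dsize L)
ι L j = tabulate (λ i → Vec.lookup (Hᵢ L i) j)

⋃ι : ∀ {n} (L : Family n) → Subset n → Subset (dsize L)
⋃ι {n} L A = ⋃ (map (ι L) (filterᵇ (Vec.lookup A) (toList (allFin n))))

dual : ∀ {n} (L : Family n) → Family (dsize L)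
dual {n} L Y = any (λ A → does (A ⊆? U L) ∧ (Y ≟ˢ ⋃ι L A)) (allSubsets n)

record _≅_ {n m} (F : Family n) (G : Family m) : Set where
  field
    to      : (a : Fin n) → a ∈ U F → Fin m
    to∈     : ∀ a (p : a ∈ U F) → to a p ∈ U G
    from    : (b : Fin m) → b ∈ U G → Fin n
    from∈   : ∀ b (q : b ∈ U G) → from b q ∈ U F
    from-to : ∀ a (p : a ∈ U F) → from (to a p) (to∈ a p) ≡ a
    to-from : ∀ b (q : b ∈ U G) → to (from b q) (from∈ b q) ≡ b
    preserves : ∀ (X : Subset n) (Y : Subset m) → X ⊆ U F → Y ⊆ U G →
                (∀ a (p : a ∈ U F) → (a ∈ X ⇔ to a p ∈ Y)) →
                (F X ≡ true ⇔ G Y ≡ true)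

-- Every member of the union-closed family N is the union of the irreducible members
-- H₁, …, H_s below it, and every member of J(N)** is a union of the sets ι*ᵢ = {k : i ∈ H*ₖ},
-- where H*₁, …, H*ₜ are the non-empty members of J(N)*. An element a of U(N) gives the
-- non-empty member ιₐ = {i : a ∈ Hᵢ} of J(N)*, and separation makes a ↦ ιₐ injective.
-- It is onto the non-empty members by counting: D ↦ ⋃_{i ∉ D} Hᵢ is injective on J(N)* and
-- maps its non-empty members into N ∖ {U(N)}, which has only |U(N)| elements, so these images
-- are all attained at some ιₐ. Sending a to the index k with H*ₖ = ιₐ gives a ∈ Hᵢ iff
-- k ∈ ι*ᵢ: the two families are generated under union by corresponding sets.

module Submission where

open import Defs
import Data.Nat as ℕ
open import Data.Nat using (ℕ; _+_; _≤_; _<_; s≤s; z≤n)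
open import Data.Nat.Properties using (≤-trans; <-≤-trans; ≤-pred; ≤-reflexive; +-comm; n≮n)
open import Data.Nat.Induction using (<-wellFounded)
open import Data.Bool using (Bool; true; false; not; _∧_; _∨_; T)
import Data.Bool as Bool
open import Data.Bool.Properties using (T-≡; ∧-conicalˡ; ∧-conicalʳ)
open import Data.Bool.ListAction using (any; all)
open import Data.Fin using (Fin; zero; suc)
open import Data.Fin.Properties using (¬∀⟶∃¬; suc-injective)
open import Data.List using (List; []; _∷_; map; filter; filterᵇ; length; lookup)
open import Data.List.Properties using (filter-notAll; length-map)
open import Data.List.Membership.Propositional using (find; lose) renaming (_∈_ to _∈ₗ_)
open import Data.List.Membership.Propositional.Properties
  using (∈-filter⁺; ∈-filter⁻; ∈-map⁺; ∈-map⁻; ∈-++⁺ˡ; ∈-++⁺ʳ; ∈-lookup)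
open import Data.List.Relation.Binary.Subset.Propositional using () renaming (_⊆_ to _⊆ₗ_)
open import Data.List.Relation.Unary.Any using (Any; here; there; index)
import Data.List.Relation.Unary.Any as Any
open import Data.List.Relation.Unary.Any.Properties using (any⁺; any⁻; lookup-index)
import Data.List.Relation.Unary.All as All
open import Data.List.Relation.Unary.AllPairs using ([]; _∷_)
open import Data.List.Relation.Unary.Unique.Propositional using (Unique)
import Data.List.Relation.Unary.Unique.Propositional.Properties as Unique
open import Data.Vec using (tabulate; allFin; toList)
import Data.Vec as Vec
open import Data.Vec.Properties using (≡-dec; []=⇒lookup; lookup⇒[]=; lookup∘tabulate; ∷-injectiveʳ)
open import Data.Vec.Membership.Propositional.Properties using (∈-allFin⁺; ∈-toList⁺)
open import Data.Fin.Subset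
  using (Subset; _∈_; _∉_; _⊆_; _⊂_; _∪_; ⋃; ∣_∣; ∁; ⁅_⁆; Nonempty; inside; outside)
  renaming (⊥ to ∅)
open import Data.Fin.Subset.Properties
  using (_∈?_; _⊆?_; nonempty?; ∉⊥; ⊆-antisym; p⊂q⇒∣p∣<∣q∣; x∈p∪q⁻; x∈p∪q⁺; p⊆p∪q; q⊆p∪q;
         x∈⁅x⁆; x∈⁅y⁆⇒x≡y; x∈∁p⇒x∉p; x∉p⇒x∈∁p)
open import Data.Empty using (⊥-elim)
open import Data.Product using (∃-syntax; _×_; _,_; proj₁; proj₂)
open import Data.Sum using (inj₁; inj₂)
open import Function using (_∘_; id)
open import Function.Bundles using (_⇔_; mk⇔; Equivalence)
open import Induction.WellFounded using (WellFounded; Acc; acc; module Subrelation)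
import Relation.Binary.Construct.On as On
open import Relation.Binary.Definitions using (DecidableEquality)
open import Relation.Binary.PropositionalEquality using (_≡_; _≢_; refl; sym; trans; cong; cong₂; subst)
open import Relation.Nullary using (Dec; yes; no; does; ¬_; ¬?; contradiction)
open import Relation.Nullary.Decidable using (dec-true; dec-false; T?; decidable-stable; _→-dec_)

private
  variable
    n m s : ℕ
    A A′ : Set

dec-true⁻ : ∀ {P : Set} (P? : Dec P) → does P? ≡ true → P
dec-true⁻ (yes p) _ = p

dec-false⁻ : ∀ {P : Set} (P? : Dec P) → does P? ≡ false → ¬ P
dec-false⁻ (no ¬p) _ = ¬p

≟ˢ⇒≡ : {X Y : Subset n} → (X ≟ˢ Y) ≡ true → X ≡ Y
≟ˢ⇒≡ {X = X} {Y} = dec-true⁻ (≡-dec Bool._≟_ X Y)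

≟ˢ-false⇒≢ : {X Y : Subset n} → (X ≟ˢ Y) ≡ false → X ≢ Y
≟ˢ-false⇒≢ {X = X} {Y} = dec-false⁻ (≡-dec Bool._≟_ X Y)

≟ˢ-refl : (X : Subset n) → (X ≟ˢ X) ≡ true
≟ˢ-refl X = dec-true (≡-dec Bool._≟_ X X) refl

≢⇒≟ˢ-false : {X Y : Subset n} → X ≢ Y → (X ≟ˢ Y) ≡ false
≢⇒≟ˢ-false {X = X} {Y} = dec-false (≡-dec Bool._≟_ X Y)

module _ (p : A → Bool) where

  ∈-filterᵇ⁺ : ∀ {x xs} → x ∈ₗ xs → p x ≡ true → x ∈ₗ filterᵇ p xs
  ∈-filterᵇ⁺ x∈ px = ∈-filter⁺ (T? ∘ p) x∈ (Equivalence.from T-≡ px)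

  ∈-filterᵇ⁻ : ∀ {x} xs → x ∈ₗ filterᵇ p xs → x ∈ₗ xs × p x ≡ true
  ∈-filterᵇ⁻ xs x∈ with x∈xs , px ← ∈-filter⁻ (T? ∘ p) {xs = xs} x∈ = x∈xs , Equivalence.to T-≡ px

  any-true⁺ : ∀ {x xs} → x ∈ₗ xs → p x ≡ true → any p xs ≡ true
  any-true⁺ x∈ px = Equivalence.to T-≡ (any⁺ p (lose x∈ (Equivalence.from T-≡ px)))

  any-true⁻ : ∀ xs → any p xs ≡ true → ∃[ x ] x ∈ₗ xs × p x ≡ true
  any-true⁻ xs eq with x , x∈ , px ← find (any⁻ p xs (Equivalence.from T-≡ eq)) =
    x , x∈ , Equivalence.to T-≡ px

  all-false⁻ : ∀ xs → all p xs ≡ false → ∃[ x ] x ∈ₗ xs × p x ≡ false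
  all-false⁻ (x ∷ xs) eq with p x in px
  ... | false = x , here refl , px
  ... | true with y , y∈ , py ← all-false⁻ xs eq = y , there y∈ , py

lookup-injective : (xs : List A) → Unique xs → ∀ i j → lookup xs i ≡ lookup xs j → i ≡ j
lookup-injective (x ∷ xs) u           zero    zero    eq = refl
lookup-injective (x ∷ xs) (x∉ ∷ u)    zero    (suc j) eq = contradiction eq (All.lookup x∉ (∈-lookup j))
lookup-injective (x ∷ xs) (x∉ ∷ u)    (suc i) zero    eq = contradiction (sym eq) (All.lookup x∉ (∈-lookup i))
lookup-injective (x ∷ xs) (x∉ ∷ u)    (suc i) (suc j) eq = cong suc (lookup-injective xs u i j eq)

map⁺-injectiveOn : (f : A → A′) {xs : List A} →
  (∀ {x y} → x ∈ₗ xs → y ∈ₗ xs → f x ≡ f y → x ≡ y) → Unique xs → Unique (map f xs)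
map⁺-injectiveOn f inj [] = []
map⁺-injectiveOn f {x ∷ xs} inj (x∉ ∷ u) =
  All.tabulate fx∉ ∷ map⁺-injectiveOn f (λ x∈ y∈ → inj (there x∈) (there y∈)) u
  where
  fx∉ : ∀ {w} → w ∈ₗ map f xs → f x ≢ w
  fx∉ w∈ eq with y , y∈ , refl ← ∈-map⁻ f w∈ = All.lookup x∉ y∈ (inj (here refl) (there y∈) eq)

module _ (_≟_ : DecidableEquality A) where

  Unique⇒length≤ : ∀ {xs ys} → Unique xs → xs ⊆ₗ ys → length xs ≤ length ys
  Unique⇒length≤ [] _ = z≤n
  Unique⇒length≤ {x ∷ xs} {ys} (x∉ ∷ u) x∷xs⊆ys = ≤-trans (s≤s (Unique⇒length≤ u xs⊆ys-x)) ys-x<ys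
    where
    ≢x? : ∀ y → Dec (x ≢ y)
    ≢x? y = ¬? (x ≟ y)

    xs⊆ys-x : xs ⊆ₗ filter ≢x? ys
    xs⊆ys-x y∈ = ∈-filter⁺ ≢x? (x∷xs⊆ys (there y∈)) (All.lookup x∉ y∈)

    ys-x<ys : length (filter ≢x? ys) < length ys
    ys-x<ys = filter-notAll ≢x? ys (Any.map (λ x≡y x≢y → x≢y x≡y) (x∷xs⊆ys (here refl)))

  Unique-⊆-length≥⇒⊇ : ∀ {xs ys} → Unique xs → xs ⊆ₗ ys → length ys ≤ length xs → ys ⊆ₗ xs
  Unique-⊆-length≥⇒⊇ {xs} {ys} u xs⊆ys ys≤xs {y} y∈ys with Any.any? (y ≟_) xs
  ... | yes y∈xs = y∈xs
  ... | no  y∉xs = contradiction (<-≤-trans (Unique⇒length≤ (y∉ ∷ u) y∷xs⊆ys) ys≤xs) (n≮n _)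
    where
    y∉ : All.All (y ≢_) xs
    y∉ = All.tabulate λ x∈ y≡x → y∉xs (subst (_∈ₗ xs) (sym y≡x) x∈)

    y∷xs⊆ys : (y ∷ xs) ⊆ₗ ys
    y∷xs⊆ys (here refl) = y∈ys
    y∷xs⊆ys (there x∈)  = xs⊆ys x∈

lookup⇒∈ : {x : Fin n} {X : Subset n} → Vec.lookup X x ≡ true → x ∈ X
lookup⇒∈ {x = x} {X} = lookup⇒[]= x X

∈-tabulate⁺ : {f : Fin n → Bool} {i : Fin n} → f i ≡ true → i ∈ tabulate f
∈-tabulate⁺ {f = f} {i} fi = lookup⇒∈ (trans (lookup∘tabulate f i) fi)

∈-tabulate⁻ : {f : Fin n → Bool} {i : Fin n} → i ∈ tabulate f → f i ≡ true
∈-tabulate⁻ {f = f} {i} i∈ = trans (sym (lookup∘tabulate f i)) ([]=⇒lookup i∈)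

⊆∧≢⇒⊂ : {X Y : Subset n} → X ⊆ Y → X ≢ Y → X ⊂ Y
⊆∧≢⇒⊂ {n} {X} {Y} X⊆Y X≢Y
  with y , ¬[y∈Y⇒y∈X] ← ¬∀⟶∃¬ n (λ y → y ∈ Y → y ∈ X) (λ y → y ∈? Y →-dec y ∈? X)
                                 (λ Y⊆X → X≢Y (⊆-antisym X⊆Y (Y⊆X _)))
  = X⊆Y , y , decidable-stable (y ∈? Y) (λ y∉Y → ¬[y∈Y⇒y∈X] (⊥-elim ∘ y∉Y))
            , λ y∈X → ¬[y∈Y⇒y∈X] (λ _ → y∈X)

⊂-wellFounded : WellFounded (_⊂_ {n})
⊂-wellFounded = Subrelation.wellFounded p⊂q⇒∣p∣<∣q∣ (On.wellFounded ∣_∣ <-wellFounded)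

∈-⋃⁺ : {x : Fin n} {X : Subset n} (Xs : List (Subset n)) → X ∈ₗ Xs → x ∈ X → x ∈ ⋃ Xs
∈-⋃⁺ (X ∷ Xs) (here refl) x∈ = x∈p∪q⁺ (inj₁ x∈)
∈-⋃⁺ (Y ∷ Xs) (there X∈)  x∈ = x∈p∪q⁺ {p = Y} (inj₂ (∈-⋃⁺ Xs X∈ x∈))

∈-⋃⁻ : {x : Fin n} (Xs : List (Subset n)) → x ∈ ⋃ Xs → ∃[ X ] X ∈ₗ Xs × x ∈ X
∈-⋃⁻ []       x∈ = contradiction x∈ ∉⊥
∈-⋃⁻ (X ∷ Xs) x∈ with x∈p∪q⁻ X (⋃ Xs) x∈
... | inj₁ x∈X = X , here refl , x∈X
... | inj₂ x∈⋃ with Y , Y∈ , x∈Y ← ∈-⋃⁻ Xs x∈⋃ = Y , there Y∈ , x∈Y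

elements : Subset n → List (Fin n)
elements Vec.[]             = []
elements (inside  Vec.∷ X) = zero ∷ map suc (elements X)
elements (outside Vec.∷ X) = map suc (elements X)

∈-elements⁻ : {x : Fin n} (X : Subset n) → x ∈ₗ elements X → x ∈ X
∈-elements⁻ (inside Vec.∷ X) (here refl) = Vec.here
∈-elements⁻ (inside Vec.∷ X) (there x∈) with y , y∈ , refl ← ∈-map⁻ suc x∈ = Vec.there (∈-elements⁻ X y∈)
∈-elements⁻ (outside Vec.∷ X) x∈        with y , y∈ , refl ← ∈-map⁻ suc x∈ = Vec.there (∈-elements⁻ X y∈)

elements-unique : (X : Subset n) → Unique (elements X)
elements-unique Vec.[]            = []
elements-unique (inside Vec.∷ X)  = All.tabulate zero∉ ∷ Unique.map⁺ suc-injective (elements-unique X)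
  where
  zero∉ : ∀ {y} → y ∈ₗ map suc (elements X) → zero ≢ y
  zero∉ y∈ with _ , _ , refl ← ∈-map⁻ suc y∈ = λ ()
elements-unique (outside Vec.∷ X) = Unique.map⁺ suc-injective (elements-unique X)

length-elements : (X : Subset n) → length (elements X) ≡ ∣ X ∣
length-elements Vec.[]            = refl
length-elements (inside Vec.∷ X)  = cong ℕ.suc (trans (length-map suc (elements X)) (length-elements X))
length-elements (outside Vec.∷ X) = trans (length-map suc (elements X)) (length-elements X)

∈-allSubsets : (X : Subset n) → X ∈ₗ allSubsets n
∈-allSubsets Vec.[]             = here refl
∈-allSubsets (outside Vec.∷ X) = ∈-++⁺ˡ (∈-map⁺ (outside Vec.∷_) (∈-allSubsets X))
∈-allSubsets {ℕ.suc n} (inside Vec.∷ X) =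
  ∈-++⁺ʳ (map (outside Vec.∷_) (allSubsets n)) (∈-map⁺ (inside Vec.∷_) (∈-allSubsets X))

allSubsets-unique : ∀ n → Unique (allSubsets n)
allSubsets-unique ℕ.zero    = All.[] ∷ []
allSubsets-unique (ℕ.suc n) = Unique.++⁺ (Unique.map⁺ ∷-injectiveʳ (allSubsets-unique n))
                                         (Unique.map⁺ ∷-injectiveʳ (allSubsets-unique n)) disjoint
  where
  disjoint : ∀ {X} → ¬ (X ∈ₗ map (outside Vec.∷_) (allSubsets n) × X ∈ₗ map (inside Vec.∷_) (allSubsets n))
  disjoint (X∈out , X∈in) with _ , _ , refl ← ∈-map⁻ (outside Vec.∷_) X∈out
                             | _ , _ , () ← ∈-map⁻ (inside Vec.∷_) X∈in

module _ (F : Family n) where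

  ∈-members⁺ : {X : Subset n} → F X ≡ true → X ∈ₗ members F
  ∈-members⁺ FX = ∈-filterᵇ⁺ F (∈-allSubsets _) FX

  ∈-members⁻ : {X : Subset n} → X ∈ₗ members F → F X ≡ true
  ∈-members⁻ X∈ = proj₂ (∈-filterᵇ⁻ F (allSubsets n) X∈)

  ∈-U⁺ : {X : Subset n} {x : Fin n} → F X ≡ true → x ∈ X → x ∈ U F
  ∈-U⁺ FX x∈ = ∈-⋃⁺ (members F) (∈-members⁺ FX) x∈

  ∈-U⁻ : {x : Fin n} → x ∈ U F → ∃[ X ] F X ≡ true × x ∈ X
  ∈-U⁻ x∈ with X , X∈ , x∈X ← ∈-⋃⁻ (members F) x∈ = X , ∈-members⁻ X∈ , x∈X

  ⋃-closed : UnionClosed F → F ∅ ≡ true → (Xs : List (Subset n)) →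
    (∀ {X} → X ∈ₗ Xs → F X ≡ true) → F (⋃ Xs) ≡ true
  ⋃-closed ∪-closed F∅ []       _   = F∅
  ⋃-closed ∪-closed F∅ (X ∷ Xs) Xs⊆ =
    ∪-closed X (⋃ Xs) (Xs⊆ (here refl)) (⋃-closed ∪-closed F∅ Xs (Xs⊆ ∘ there))

  U-member : UnionClosed F → F ∅ ≡ true → F (U F) ≡ true
  U-member ∪-closed F∅ = ⋃-closed ∪-closed F∅ (members F) ∈-members⁻

-- ⋃ι L from Defs is definitionally ⋃ᵢ (ι L).
⋃ᵢ : (Fin m → Subset n) → Subset m → Subset n
⋃ᵢ {m} f B = ⋃ (map f (filterᵇ (Vec.lookup B) (toList (allFin m))))

module _ (f : Fin m → Subset n) where

  ∈-⋃ᵢ⁺ : {B : Subset m} {x : Fin n} (i : Fin m) → i ∈ B → x ∈ f i → x ∈ ⋃ᵢ f B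
  ∈-⋃ᵢ⁺ {B} i i∈B x∈ =
    ∈-⋃⁺ _ (∈-map⁺ f (∈-filterᵇ⁺ (Vec.lookup B) (∈-toList⁺ (∈-allFin⁺ i)) ([]=⇒lookup i∈B))) x∈

  ∈-⋃ᵢ⁻ : (B : Subset m) {x : Fin n} → x ∈ ⋃ᵢ f B → ∃[ i ] i ∈ B × x ∈ f i
  ∈-⋃ᵢ⁻ B x∈ with ∈-⋃⁻ _ x∈
  ... | X , X∈ , x∈X with ∈-map⁻ f X∈
  ... | i , i∈ , refl =
    i , lookup⇒∈ (proj₂ (∈-filterᵇ⁻ (Vec.lookup B) (toList (allFin m)) i∈)) , x∈X

  ⋃ᵢ-⁅⁆ : (i : Fin m) → ⋃ᵢ f ⁅ i ⁆ ≡ f i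
  ⋃ᵢ-⁅⁆ i = ⊆-antisym ⋃⊆fi (∈-⋃ᵢ⁺ i (x∈⁅x⁆ i))
    where
    ⋃⊆fi : ⋃ᵢ f ⁅ i ⁆ ⊆ f i
    ⋃⊆fi {x} x∈ with j , j∈ , x∈fj ← ∈-⋃ᵢ⁻ ⁅ i ⁆ x∈ = subst (λ k → x ∈ f k) (x∈⁅y⁆⇒x≡y i j∈) x∈fj

  ⋃ᵢ-closed : (F : Family n) → UnionClosed F → F ∅ ≡ true → (∀ i → F (f i) ≡ true) →
    (B : Subset m) → F (⋃ᵢ f B) ≡ true
  ⋃ᵢ-closed F ∪-closed F∅ Ff B = ⋃-closed F ∪-closed F∅ _ Ff∈
    where
    Ff∈ : ∀ {X} → X ∈ₗ map f (filterᵇ (Vec.lookup B) (toList (allFin m))) → F X ≡ true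
    Ff∈ X∈ with i , _ , refl ← ∈-map⁻ f X∈ = Ff i

module _ (L : Family n) where

  private
    Hᵢ-spec : ∀ i → L (Hᵢ L i) ∧ does (nonempty? (Hᵢ L i)) ≡ true
    Hᵢ-spec i = proj₂ (∈-filterᵇ⁻ _ (allSubsets n) (∈-lookup i))

  Hᵢ-member : ∀ i → L (Hᵢ L i) ≡ true
  Hᵢ-member i = ∧-conicalˡ _ _ (Hᵢ-spec i)

  Hᵢ-nonempty : ∀ i → Nonempty (Hᵢ L i)
  Hᵢ-nonempty i = dec-true⁻ (nonempty? _) (∧-conicalʳ _ _ (Hᵢ-spec i))

  Hᵢ-surjective : {X : Subset n} → L X ≡ true → Nonempty X → ∃[ i ] Hᵢ L i ≡ X
  Hᵢ-surjective {X} LX X≢∅ = index X∈ , sym (lookup-index X∈)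
    where
    X∈ : X ∈ₗ nonemptyMembers L
    X∈ = ∈-filterᵇ⁺ _ (∈-allSubsets X) (cong₂ _∧_ LX (dec-true (nonempty? X) X≢∅))

  Hᵢ-injective : ∀ i j → Hᵢ L i ≡ Hᵢ L j → i ≡ j
  Hᵢ-injective = lookup-injective _ (Unique.filter⁺ _ (allSubsets-unique n))

  ∈-ι⁺ : {i : Fin (dsize L)} {j : Fin n} → j ∈ Hᵢ L i → i ∈ ι L j
  ∈-ι⁺ j∈ = ∈-tabulate⁺ ([]=⇒lookup j∈)

  ∈-ι⁻ : {i : Fin (dsize L)} {j : Fin n} → i ∈ ι L j → j ∈ Hᵢ L i
  ∈-ι⁻ i∈ = lookup⇒∈ (∈-tabulate⁻ i∈)

  dual⁺ : (A : Subset n) → A ⊆ U L → dual L (⋃ι L A) ≡ true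
  dual⁺ A A⊆ = any-true⁺ _ (∈-allSubsets A) (cong₂ _∧_ (dec-true (A ⊆? U L) A⊆) (≟ˢ-refl (⋃ι L A)))

  dual⁻ : {Y : Subset (dsize L)} → dual L Y ≡ true → ∃[ A ] A ⊆ U L × Y ≡ ⋃ι L A
  dual⁻ LY with A , _ , spec ← any-true⁻ _ (allSubsets n) LY =
    A , dec-true⁻ (A ⊆? U L) (∧-conicalˡ _ _ spec) , ≟ˢ⇒≡ (∧-conicalʳ _ _ spec)

  ι∈dual : {j : Fin n} → j ∈ U L → dual L (ι L j) ≡ true
  ι∈dual {j} j∈ = subst (λ Y → dual L Y ≡ true) (⋃ᵢ-⁅⁆ (ι L) j) (dual⁺ ⁅ j ⁆ ⁅j⁆⊆)
    where
    ⁅j⁆⊆ : ⁅ j ⁆ ⊆ U L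
    ⁅j⁆⊆ x∈ = subst (_∈ U L) (sym (x∈⁅y⁆⇒x≡y j x∈)) j∈

  ι-nonempty : {j : Fin n} → j ∈ U L → Nonempty (ι L j)
  ι-nonempty j∈ with X , LX , j∈X ← ∈-U⁻ L j∈ with i , refl ← Hᵢ-surjective LX (_ , j∈X) = i , ∈-ι⁺ j∈X

  ∈-U-dual : ∀ i → i ∈ U (dual L)
  ∈-U-dual i with j , j∈ ← Hᵢ-nonempty i = ∈-U⁺ (dual L) (ι∈dual (∈-U⁺ L (Hᵢ-member i) j∈)) (∈-ι⁺ j∈)

  dual⇔⋃ι : (∀ j → j ∈ U L) → ∀ Y → dual L Y ≡ true ⇔ (∃[ B ] Y ≡ ⋃ᵢ (ι L) B)
  dual⇔⋃ι U-full Y = mk⇔ (λ LY → let A , _ , Y≡ = dual⁻ LY in A , Y≡)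
                          (λ { (A , refl) → dual⁺ A (λ {j} _ → U-full j) })

  ⋃∁ : Subset (dsize L) → Subset n
  ⋃∁ D = ⋃ᵢ (Hᵢ L) (∁ D)

  Hᵢ⊆⋃∁ : {D : Subset (dsize L)} {i : Fin (dsize L)} → i ∉ D → Hᵢ L i ⊆ ⋃∁ D
  Hᵢ⊆⋃∁ i∉D = ∈-⋃ᵢ⁺ (Hᵢ L) _ (x∉p⇒x∈∁p i∉D)

  Hᵢ⊈⋃∁ : {D : Subset (dsize L)} {i : Fin (dsize L)} → dual L D ≡ true → i ∈ D → ¬ (Hᵢ L i ⊆ ⋃∁ D)
  Hᵢ⊈⋃∁ {D} {i} LD i∈D Hᵢ⊆ with A , _ , refl ← dual⁻ {D} LD
    with j , j∈A , i∈ιj ← ∈-⋃ᵢ⁻ (ι L) A i∈D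
    with i′ , i′∈∁D , j∈Hᵢ′ ← ∈-⋃ᵢ⁻ (Hᵢ L) (∁ D) (Hᵢ⊆ (∈-ι⁻ i∈ιj))
    = x∈∁p⇒x∉p i′∈∁D (∈-⋃ᵢ⁺ (ι L) j j∈A (∈-ι⁺ j∈Hᵢ′))

  ⋃∁-injective : (D D′ : Subset (dsize L)) → dual L D ≡ true → dual L D′ ≡ true → ⋃∁ D ≡ ⋃∁ D′ → D ≡ D′
  ⋃∁-injective D D′ LD LD′ eq = ⊆-antisym (⊆ LD eq) (⊆ LD′ (sym eq))
    where
    ⊆ : ∀ {D D′} → dual L D ≡ true → ⋃∁ D ≡ ⋃∁ D′ → D ⊆ D′
    ⊆ {D} {D′} LD eq {i} i∈D = decidable-stable (i ∈? D′)
      (λ i∉D′ → Hᵢ⊈⋃∁ LD i∈D (subst (Hᵢ L i ⊆_) (sym eq) (Hᵢ⊆⋃∁ i∉D′)))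

  ⋃∁≢U : (D : Subset (dsize L)) → dual L D ≡ true → Nonempty D → ⋃∁ D ≢ U L
  ⋃∁≢U D LD (i , i∈D) eq = Hᵢ⊈⋃∁ LD i∈D (subst (Hᵢ L i ⊆_) (sym eq) (∈-U⁺ L (Hᵢ-member i)))

private
  implication-false : ∀ a b c d e → (not (a ∧ b ∧ c) ∨ d ∨ e) ≡ false →
    a ≡ true × b ≡ true × c ≡ true × d ≡ false × e ≡ false
  implication-false false _     _     _     _     ()
  implication-false true  false _     _     _     ()
  implication-false true  true  false _     _     ()
  implication-false true  true  true  true  _     ()
  implication-false true  true  true  false true  ()
  implication-false true  true  true  false false _ = refl , refl , refl , refl , refl

module _ (F : Family n) where

  ¬irreducible⇒split : {X : Subset n} → irreducible F X ≡ false →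
    ∃[ G ] ∃[ H ] F G ≡ true × F H ≡ true × G ∪ H ≡ X × G ≢ X × H ≢ X
  ¬irreducible⇒split {X} irr
    with G , _ , G-fails ← all-false⁻ _ (allSubsets n) irr
    with H , _ , GH-fails ← all-false⁻ _ (allSubsets n) G-fails
    with FG , FH , G∪H≡X , G≢X , H≢X ← implication-false (F G) (F H) ((G ∪ H) ≟ˢ X) (G ≟ˢ X) (H ≟ˢ X) GH-fails
    = G , H , FG , FH , ≟ˢ⇒≡ G∪H≡X , ≟ˢ-false⇒≢ G≢X , ≟ˢ-false⇒≢ H≢X

  J-member : {X : Subset n} → J F X ≡ true → F X ≡ true
  J-member = ∧-conicalˡ _ _

  irreducible-below : {X : Subset n} {a : Fin n} → F X ≡ true → a ∈ X →
    ∃[ K ] J F K ≡ true × a ∈ K × K ⊆ X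
  irreducible-below {X} = go (⊂-wellFounded X)
    where
    go : ∀ {X a} → Acc _⊂_ X → F X ≡ true → a ∈ X → ∃[ K ] J F K ≡ true × a ∈ K × K ⊆ X
    go {X} {a} (acc smaller) FX a∈X with irreducible F X in irr
    ... | true = X , cong₂ _∧_ FX (cong₂ _∧_ (dec-true (nonempty? X) (a , a∈X)) irr) , a∈X , id
    ... | false with G , H , FG , FH , refl , G≢ , H≢ ← ¬irreducible⇒split irr with x∈p∪q⁻ G H a∈X
    ... | inj₁ a∈G with K , JK , a∈K , K⊆G ← go (smaller (⊆∧≢⇒⊂ (p⊆p∪q H) G≢)) FG a∈G =
      K , JK , a∈K , p⊆p∪q H ∘ K⊆G
    ... | inj₂ a∈H with K , JK , a∈K , K⊆H ← go (smaller (⊆∧≢⇒⊂ (q⊆p∪q G H) H≢)) FH a∈H =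
      K , JK , a∈K , q⊆p∪q G H ∘ K⊆H

  irreducible-index : {X : Subset n} {a : Fin n} → F X ≡ true → a ∈ X →
    ∃[ i ] a ∈ Hᵢ (J F) i × Hᵢ (J F) i ⊆ X
  irreducible-index FX a∈X
    with K , JK , a∈K , K⊆X ← irreducible-below FX a∈X
    with i , refl ← Hᵢ-surjective (J F) JK (_ , a∈K)
    = i , a∈K , K⊆X

  U-J : U (J F) ≡ U F
  U-J = ⊆-antisym (λ a∈ → let K , JK , a∈K = ∈-U⁻ (J F) a∈ in ∈-U⁺ F (J-member JK) a∈K)
                  (λ a∈ → let X , FX , a∈X = ∈-U⁻ F a∈
                              i , a∈Hᵢ , _ = irreducible-index FX a∈X
                          in ∈-U⁺ (J F) (Hᵢ-member (J F) i) a∈Hᵢ)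

  member⇔⋃J : UnionClosed F → F ∅ ≡ true → ∀ X → F X ≡ true ⇔ (∃[ B ] X ≡ ⋃ᵢ (Hᵢ (J F)) B)
  member⇔⋃J ∪-closed F∅ X = mk⇔ (λ FX → below , ⊆-antisym (⊆⋃ FX) ⋃⊆)
    (λ { (B , refl) → ⋃ᵢ-closed (Hᵢ (J F)) F ∪-closed F∅ (J-member ∘ Hᵢ-member (J F)) B })
    where
    below : Subset (dsize (J F))
    below = tabulate (λ i → does (Hᵢ (J F) i ⊆? X))

    ⊆⋃ : F X ≡ true → X ⊆ ⋃ᵢ (Hᵢ (J F)) below
    ⊆⋃ FX x∈X with i , x∈Hᵢ , Hᵢ⊆X ← irreducible-index FX x∈X =
      ∈-⋃ᵢ⁺ (Hᵢ (J F)) i (∈-tabulate⁺ (dec-true (_ ⊆? X) Hᵢ⊆X)) x∈Hᵢ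

    ⋃⊆ : ⋃ᵢ (Hᵢ (J F)) below ⊆ X
    ⋃⊆ x∈ with i , i∈ , x∈Hᵢ ← ∈-⋃ᵢ⁻ (Hᵢ (J F)) below x∈ =
      dec-true⁻ (_ ⊆? X) (∈-tabulate⁻ i∈) x∈Hᵢ

  ι-J-separates : {O : Subset n} {x y : Fin n} → F O ≡ true → x ∈ O → y ∉ O → ι (J F) x ≢ ι (J F) y
  ι-J-separates FO x∈O y∉O ιx≡ιy with i , x∈Hᵢ , Hᵢ⊆O ← irreducible-index FO x∈O =
    y∉O (Hᵢ⊆O (∈-ι⁻ (J F) (subst (i ∈_) ιx≡ιy (∈-ι⁺ (J F) x∈Hᵢ))))

  ι-J-injective : Separating F → {a b : Fin n} → a ∈ U F → b ∈ U F → ι (J F) a ≡ ι (J F) b → a ≡ b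
  ι-J-injective separating {a} {b} a∈ b∈ ιa≡ιb with a Data.Fin.≟ b
  ... | yes a≡b = a≡b
  ... | no  a≢b with separating a b a∈ b∈ a≢b
  ... | O , FO , inj₁ (a∈O , b∉O) = ⊥-elim (ι-J-separates FO a∈O b∉O ιa≡ιb)
  ... | O , FO , inj₂ (a∉O , b∈O) = ⊥-elim (ι-J-separates FO b∈O a∉O (sym ιa≡ιb))

module _ (F : Family m) (Z : Subset m) (P : Subset n) (h : Fin n → Subset m) where

  injection-hits-all-but : card F ≤ ∣ P ∣ + 1 → F Z ≡ true →
    (∀ {a} → a ∈ P → F (h a) ≡ true) → (∀ {a} → a ∈ P → h a ≢ Z) →
    (∀ {a b} → a ∈ P → b ∈ P → h a ≡ h b → a ≡ b) →
    ∀ {X} → F X ≡ true → X ≢ Z → ∃[ a ] a ∈ P × h a ≡ X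
  injection-hits-all-but card≤ FZ Fh h≢Z h-injective {X} FX X≢Z =
    let a , a∈ , X≡ha = ∈-map⁻ h X∈image in a , ∈-elements⁻ P a∈ , sym X≡ha
    where
    image : List (Subset m)
    image = map h (elements P)

    others : List (Subset m)
    others = filterᵇ (λ Y → not (Y ≟ˢ Z)) (members F)

    ∈-others : ∀ {Y} → F Y ≡ true → Y ≢ Z → Y ∈ₗ others
    ∈-others FY Y≢Z = ∈-filterᵇ⁺ _ (∈-members⁺ F FY) (cong not (≢⇒≟ˢ-false Y≢Z))

    Unique-image : Unique image
    Unique-image =
      map⁺-injectiveOn h (λ a∈ b∈ → h-injective (∈-elements⁻ P a∈) (∈-elements⁻ P b∈)) (elements-unique P)

    image⊆others : image ⊆ₗ others
    image⊆others Y∈ with a , a∈ , refl ← ∈-map⁻ h Y∈ = ∈-others (Fh (∈-elements⁻ P a∈)) (h≢Z (∈-elements⁻ P a∈))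

    others<card : length others < card F
    others<card =
      filter-notAll _ (members F) (Any.map (λ { refl → subst (T ∘ not) (≟ˢ-refl Z) }) (∈-members⁺ F FZ))

    others≤image : length others ≤ length image
    others≤image = ≤-trans (≤-pred (subst (length others <_) (+-comm ∣ P ∣ 1) (<-≤-trans others<card card≤)))
                           (≤-reflexive (sym (trans (length-map h (elements P)) (length-elements P))))

    X∈image : X ∈ₗ image
    X∈image = Unique-⊆-length≥⇒⊇ (≡-dec Bool._≟_) Unique-image image⊆others others≤image (∈-others FX X≢Z)

record _⇿_ (P : Subset n) (Q : Subset m) : Set where
  field
    to      : (a : Fin n) → a ∈ P → Fin m
    to∈     : ∀ a (p : a ∈ P) → to a p ∈ Q
    from    : (b : Fin m) → b ∈ Q → Fin n
    from∈   : ∀ b (q : b ∈ Q) → from b q ∈ P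
    from-to : ∀ a (p : a ∈ P) → from (to a p) (to∈ a p) ≡ a
    to-from : ∀ b (q : b ∈ Q) → to (from b q) (from∈ b q) ≡ b

  Corresponds : Subset n → Subset m → Set
  Corresponds X Y = ∀ a (p : a ∈ P) → a ∈ X ⇔ to a p ∈ Y

  image-⊆ : {X : Subset n} {Y Y′ : Subset m} → Y ⊆ Q → Corresponds X Y → Corresponds X Y′ → Y ⊆ Y′
  image-⊆ {Y = Y} {Y′} Y⊆Q XY XY′ {b} b∈Y =
    subst (_∈ Y′) (to-from b q)
      (Equivalence.to (XY′ _ p) (Equivalence.from (XY _ p) (subst (_∈ Y) (sym (to-from b q)) b∈Y)))
    where
    q : b ∈ Q
    q = Y⊆Q b∈Y
    p : from b q ∈ P
    p = from∈ b q

  image-unique : {X : Subset n} {Y Y′ : Subset m} → Y ⊆ Q → Y′ ⊆ Q →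
    Corresponds X Y → Corresponds X Y′ → Y ≡ Y′
  image-unique Y⊆Q Y′⊆Q XY XY′ = ⊆-antisym (image-⊆ Y⊆Q XY XY′) (image-⊆ Y′⊆Q XY′ XY)

  preimage-⊆ : {X X′ : Subset n} {Y : Subset m} → X ⊆ P → Corresponds X Y → Corresponds X′ Y → X ⊆ X′
  preimage-⊆ X⊆P XY X′Y a∈X = Equivalence.from (X′Y _ (X⊆P a∈X)) (Equivalence.to (XY _ (X⊆P a∈X)) a∈X)

  preimage-unique : {X X′ : Subset n} {Y : Subset m} → X ⊆ P → X′ ⊆ P →
    Corresponds X Y → Corresponds X′ Y → X ≡ X′
  preimage-unique X⊆P X′⊆P XY X′Y = ⊆-antisym (preimage-⊆ X⊆P XY X′Y) (preimage-⊆ X′⊆P X′Y XY)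

module _ {F : Family n} {G : Family m} (φ : U F ⇿ U G) (f : Fin s → Subset n) (g : Fin s → Subset m)
         (F⇔⋃f : ∀ X → F X ≡ true ⇔ (∃[ B ] X ≡ ⋃ᵢ f B))
         (G⇔⋃g : ∀ Y → G Y ≡ true ⇔ (∃[ B ] Y ≡ ⋃ᵢ g B))
         (f∼g : ∀ i → _⇿_.Corresponds φ (f i) (g i)) where

  open _⇿_ φ

  private
    ⋃f⊆U : (B : Subset s) → ⋃ᵢ f B ⊆ U F
    ⋃f⊆U B = ∈-U⁺ F (Equivalence.from (F⇔⋃f (⋃ᵢ f B)) (B , refl))

    ⋃g⊆U : (B : Subset s) → ⋃ᵢ g B ⊆ U G
    ⋃g⊆U B = ∈-U⁺ G (Equivalence.from (G⇔⋃g (⋃ᵢ g B)) (B , refl))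

    ⋃f∼⋃g : (B : Subset s) → Corresponds (⋃ᵢ f B) (⋃ᵢ g B)
    ⋃f∼⋃g B a p = mk⇔
      (λ a∈ → let i , i∈B , a∈fi = ∈-⋃ᵢ⁻ f B a∈ in ∈-⋃ᵢ⁺ g i i∈B (Equivalence.to (f∼g i a p) a∈fi))
      (λ b∈ → let i , i∈B , b∈gi = ∈-⋃ᵢ⁻ g B b∈ in ∈-⋃ᵢ⁺ f i i∈B (Equivalence.from (f∼g i a p) b∈gi))

    member⇒member : {X : Subset n} {Y : Subset m} → Y ⊆ U G → Corresponds X Y → F X ≡ true → G Y ≡ true
    member⇒member Y⊆ XY FX with B , refl ← Equivalence.to (F⇔⋃f _) FX =
      Equivalence.from (G⇔⋃g _) (B , image-unique Y⊆ (⋃g⊆U B) XY (⋃f∼⋃g B))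

    member⇐member : {X : Subset n} {Y : Subset m} → X ⊆ U F → Corresponds X Y → G Y ≡ true → F X ≡ true
    member⇐member X⊆ XY GY with B , refl ← Equivalence.to (G⇔⋃g _) GY =
      Equivalence.from (F⇔⋃f _) (B , preimage-unique X⊆ (⋃f⊆U B) XY (⋃f∼⋃g B))

  ≅-generated : F ≅ G
  ≅-generated = record
    { to = to ; to∈ = to∈ ; from = from ; from∈ = from∈ ; from-to = from-to ; to-from = to-from
    ; preserves = λ X Y X⊆ Y⊆ XY → mk⇔ (member⇒member Y⊆ XY) (member⇐member X⊆ XY)
    }

module _ (N : Family n) (normalized : Normalized N) where

  open Normalized normalized

  private
    U⊆U-J : {a : Fin n} → a ∈ U N → a ∈ U (J N)
    U⊆U-J = subst (_ ∈_) (sym (U-J N))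

    ι∈dual-J : {a : Fin n} → a ∈ U N → dual (J N) (ι (J N) a) ≡ true
    ι∈dual-J = ι∈dual (J N) ∘ U⊆U-J

    ι-J-nonempty : {a : Fin n} → a ∈ U N → Nonempty (ι (J N) a)
    ι-J-nonempty = ι-nonempty (J N) ∘ U⊆U-J

  dual-J-nonempty⇒ι : {D : Subset (dsize (J N))} → dual (J N) D ≡ true → Nonempty D →
    ∃[ a ] a ∈ U N × ι (J N) a ≡ D
  dual-J-nonempty⇒ι {D} LD D≢∅ =
    let a , a∈U , ⋃∁ιa≡⋃∁D = injection-hits-all-but N (U N) (U N) (⋃∁ (J N) ∘ ι (J N))
                               (≤-reflexive cardinality) (U-member N unionClosed hasEmpty)
                               (λ {a} _ → ⋃∁∈N (ι (J N) a)) ⋃∁ι≢UN ⋃∁ι-injective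
                               (⋃∁∈N D) (⋃∁≢UN D LD D≢∅)
    in a , a∈U , ⋃∁-injective (J N) _ D (ι∈dual-J a∈U) LD ⋃∁ιa≡⋃∁D
    where
    ⋃∁∈N : ∀ D → N (⋃∁ (J N) D) ≡ true
    ⋃∁∈N D = ⋃ᵢ-closed (Hᵢ (J N)) N unionClosed hasEmpty (J-member N ∘ Hᵢ-member (J N)) (∁ D)

    ⋃∁≢UN : ∀ D → dual (J N) D ≡ true → Nonempty D → ⋃∁ (J N) D ≢ U N
    ⋃∁≢UN D LD D≢∅ = subst (⋃∁ (J N) D ≢_) (U-J N) (⋃∁≢U (J N) D LD D≢∅)

    ⋃∁ι≢UN : ∀ {a} → a ∈ U N → ⋃∁ (J N) (ι (J N) a) ≢ U N
    ⋃∁ι≢UN {a} a∈ = ⋃∁≢UN (ι (J N) a) (ι∈dual-J a∈) (ι-J-nonempty a∈)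

    ⋃∁ι-injective : ∀ {a b} → a ∈ U N → b ∈ U N → ⋃∁ (J N) (ι (J N) a) ≡ ⋃∁ (J N) (ι (J N) b) → a ≡ b
    ⋃∁ι-injective a∈ b∈ eq =
      ι-J-injective N separating a∈ b∈ (⋃∁-injective (J N) _ _ (ι∈dual-J a∈) (ι∈dual-J b∈) eq)

  private
    index-of : ∀ {a} → a ∈ U N → ∃[ k ] Hᵢ (dual (J N)) k ≡ ι (J N) a
    index-of p = Hᵢ-surjective (dual (J N)) (ι∈dual-J p) (ι-J-nonempty p)

    element-at : ∀ k → ∃[ a ] a ∈ U N × ι (J N) a ≡ Hᵢ (dual (J N)) k
    element-at k = dual-J-nonempty⇒ι (Hᵢ-member (dual (J N)) k) (Hᵢ-nonempty (dual (J N)) k)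

  U⇿U-dual-dual-J : U N ⇿ U (dual (dual (J N)))
  U⇿U-dual-dual-J = record
    { to      = λ a p → proj₁ (index-of p)
    ; to∈     = λ _ _ → ∈-U-dual (dual (J N)) _
    ; from    = λ k _ → proj₁ (element-at k)
    ; from∈   = λ k _ → proj₁ (proj₂ (element-at k))
    ; from-to = λ a p → ι-J-injective N separating (proj₁ (proj₂ (element-at _))) p
                          (trans (proj₂ (proj₂ (element-at _))) (proj₂ (index-of p)))
    ; to-from = λ k _ → Hᵢ-injective (dual (J N)) _ k
                          (trans (proj₂ (index-of _)) (proj₂ (proj₂ (element-at k))))
    }

  Hᵢ∼ι : ∀ i → _⇿_.Corresponds U⇿U-dual-dual-J (Hᵢ (J N) i) (ι (dual (J N)) i)
  Hᵢ∼ι i a p = mk⇔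
    (λ a∈Hᵢ → ∈-ι⁺ (dual (J N)) (subst (i ∈_) (sym k≡) (∈-ι⁺ (J N) a∈Hᵢ)))
    (λ k∈ι → ∈-ι⁻ (J N) (subst (i ∈_) k≡ (∈-ι⁻ (dual (J N)) k∈ι)))
    where
    k≡ : Hᵢ (dual (J N)) (proj₁ (index-of p)) ≡ ι (J N) a
    k≡ = proj₂ (index-of p)

proposition4p6 : (n : ℕ) (N : Family n) → Normalized N → N ≅ dual (dual (J N))
proposition4p6 n N normalized =
  ≅-generated (U⇿U-dual-dual-J N normalized) (Hᵢ (J N)) (ι (dual (J N)))
    (member⇔⋃J N unionClosed hasEmpty)
    (dual⇔⋃ι (dual (J N)) (∈-U-dual (J N)))
    (Hᵢ∼ι N normalized)
  where open Normalized normalized
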